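{- Let $n\geq 1$ be an integer and let \[ A(n):=\left|\left\{k\in\mathbb{Z}: 1\leq k\leq 2\lfloor n/4\rfloor-1,\ n\mid k^2\right\}\right|. \] Then: (a) If $4\nmid n$ and $n=P\cdot Q^2$ with $P$ squarefree and $Q$ a positive integer, then $A(n)=\frac{1}{2}(Q-1)$. (b) If $n=4\cdot P\cdot Q^2$ with $P$ squarefree and $Q$ a positive integer, then $A(n)=Q-1$.
   Context: $\lfloor x\rfloor$ denotes the floor function. -}

module Defs where

open import Data.Nat using (ℕ; suc; _*_; _∸_; _/_)
open import Data.Nat.Divisibility using (_∣_; _∣?_)
open import Data.List using (List; length; filter; map; upTo)
open import Relation.Binary.PropositionalEquality using (_≡_)

SquareFree : ℕ → Set
SquareFree P = ∀ d → d * d ∣ P → d ≡ 1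

range1 : ℕ → List ℕ
range1 m = map suc (upTo m)

-- A(n) = #{ k : 1 ≤ k ≤ 2⌊n/4⌋ - 1, n ∣ k² }
-- (when 2⌊n/4⌋ - 1 < 1 the range is empty; truncated subtraction gives the same)
A : ℕ → ℕ
A n = length (filter (λ k → n ∣? (k * k)) (range1 (2 * (n / 4) ∸ 1)))

-- A squarefree number dividing j² divides j, so for squarefree P a square k² is divisible by P·Q²
-- exactly when P·Q divides k; hence A(P·Q²) counts the multiples of P·Q up to 2⌊n/4⌋ − 1 and equals
-- ⌊(2⌊n/4⌋ − 1)/(P·Q)⌋. For n = 4PQ² = P(2Q)² this is ⌊(2PQ² − 1)/(2PQ)⌋ = Q − 1. If 4 ∤ n then
-- Q = 2h + 1 is odd, n = P + 4P(h² + h), and 2⌊n/4⌋ − 1 = 2P(h² + h) + 2⌊P/4⌋ − 1 lies in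
-- [hPQ, (h + 1)PQ) because 2⌊P/4⌋ < P.
module Submission where

open import Defs
open import Data.Nat using (ℕ; zero; suc; _+_; _*_; _∸_; _/_; _%_; _≤_; _<_; _≥_; z≤n; s≤s; s≤s⁻¹; NonZero; ≢-nonZero; ≢-nonZero⁻¹; >-nonZero⁻¹)
open import Data.Nat.Properties
open import Data.Nat.Divisibility
open import Data.Nat.DivMod
open import Data.Nat.GCD using (gcd; gcd[m,n]∣m; gcd[m,n]∣n; gcd[m,n]≢0)
open import Data.Nat.Coprimality using (Coprime; coprime-/gcd; coprime-divisor)
open import Data.Nat.Tactic.RingSolver using (solve-∀)
open import Data.List using (length; filter; map; upTo; _++_; [_])
open import Data.List.Properties using (filter-++; filter-accept; filter-reject; filter-≐; length-++; map-++; upTo-∷ʳ)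
open import Data.Product using (_×_; _,_)
open import Data.Sum using (inj₁)
open import Function using (_∘_)
open import Relation.Nullary using (¬_; contradiction)
open import Relation.Binary.PropositionalEquality using (_≡_; refl; sym; trans; cong; cong₂; subst; subst₂; module ≡-Reasoning)

record GcdCofactors (a b : ℕ) : Set where
  field
    g a′ b′ : ℕ
    g≢0 : NonZero g
    a≡a′*g : a ≡ a′ * g
    b≡b′*g : b ≡ b′ * g
    coprime : Coprime a′ b′

  ∣-cofactors⇒∣ : a′ ∣ b′ → a ∣ b
  ∣-cofactors⇒∣ a′∣b′ = subst₂ _∣_ (sym a≡a′*g) (sym b≡b′*g) (*-monoˡ-∣ g a′∣b′)

gcdCofactors : ∀ a b .{{_ : NonZero a}} → GcdCofactors a b
gcdCofactors a b = record
  { g = gcd a b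
  ; a′ = a / gcd a b
  ; b′ = b / gcd a b
  ; a≡a′*g = sym (m/n*n≡m (gcd[m,n]∣m a b))
  ; b≡b′*g = sym (m/n*n≡m (gcd[m,n]∣n a b))
  ; g≢0 = gcd≢0
  ; coprime = coprime-/gcd a b
  }
  where
  instance
    gcd≢0 : NonZero (gcd a b)
    gcd≢0 = ≢-nonZero (gcd[m,n]≢0 a b (inj₁ (≢-nonZero⁻¹ a)))

m*m∣n*n⇒m∣n : ∀ m n .{{_ : NonZero m}} → m * m ∣ n * n → m ∣ n
m*m∣n*n⇒m∣n m n m²∣n² = ∣-cofactors⇒∣ (coprime-divisor coprime a′∣b′²)
  where
  open GcdCofactors (gcdCofactors m n)
  a′∣b′² : a′ ∣ b′ * b′
  a′∣b′² = ∣-trans (m∣m*n a′) (*-cancelʳ-∣ (g * g) {{m*n≢0 g g {{g≢0}} {{g≢0}}}} (subst₂ _∣_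
    (trans (cong₂ _*_ a≡a′*g a≡a′*g) ([m*n]*[o*p]≡[m*o]*[n*p] a′ g a′ g))
    (trans (cong₂ _*_ b≡b′*g b≡b′*g) ([m*n]*[o*p]≡[m*o]*[n*p] b′ g b′ g))
    m²∣n²))

squareFree⇒nonZero : ∀ {P} → SquareFree P → NonZero P
squareFree⇒nonZero {zero} sf = contradiction (sf 2 (4 ∣0)) λ ()
squareFree⇒nonZero {suc _} _ = _

squareFree-∣-square : ∀ {P j} → SquareFree P → P ∣ j * j → P ∣ j
squareFree-∣-square {P} {j} sf P∣j² =
  ∣-cofactors⇒∣ (subst (_∣ b′) (sym a′≡1) (1∣ b′))
  where
  instance
    P≢0 : NonZero P
    P≢0 = squareFree⇒nonZero sf
  open GcdCofactors (gcdCofactors P j)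
  [xy][xy]≡[x[xy]]y : ∀ x y → (x * y) * (x * y) ≡ (x * (x * y)) * y
  [xy][xy]≡[x[xy]]y = solve-∀
  -- a′ is coprime to b′ and divides b′² g, hence divides g; so a′² divides a′ g = P.
  a′∣g : a′ ∣ g
  a′∣g = coprime-divisor coprime (coprime-divisor coprime (*-cancelʳ-∣ g {{g≢0}}
    (subst₂ _∣_ a≡a′*g (trans (cong₂ _*_ b≡b′*g b≡b′*g) ([xy][xy]≡[x[xy]]y b′ g)) P∣j²)))
  a′≡1 : a′ ≡ 1
  a′≡1 = sf a′ (subst (a′ * a′ ∣_) (sym (trans a≡a′*g (*-comm a′ g)))
    (*-monoˡ-∣ a′ a′∣g))

P*Q²∣k²⇒P*Q∣k : ∀ {P} Q k .{{_ : NonZero Q}} → SquareFree P →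
                P * (Q * Q) ∣ k * k → P * Q ∣ k
P*Q²∣k²⇒P*Q∣k {P} Q k sf PQ²∣k² with m*m∣n*n⇒m∣n Q k (∣-trans (n∣m*n P) PQ²∣k²)
... | divides-refl j = *-monoˡ-∣ Q (squareFree-∣-square {j = j} sf (*-cancelʳ-∣ (Q * Q) {{m*n≢0 Q Q}}
  (subst (P * (Q * Q) ∣_) ([m*n]*[o*p]≡[m*o]*[n*p] j Q j Q) PQ²∣k²)))

P*Q∣k⇒P*Q²∣k² : ∀ P Q {k} → P * Q ∣ k → P * (Q * Q) ∣ k * k
P*Q∣k⇒P*Q²∣k² P Q PQ∣k = ∣-trans
  (subst (P * (Q * Q) ∣_) (sym (trans ([m*n]*[o*p]≡[m*o]*[n*p] P Q P Q) (*-assoc P P (Q * Q))))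
    (n∣m*n P))
  (*-pres-∣ PQ∣k PQ∣k)

countMultiples : ℕ → ℕ → ℕ
countMultiples d m = length (filter (d ∣?_) (range1 m))

range1-suc : ∀ m → range1 (suc m) ≡ range1 m ++ [ suc m ]
range1-suc m = trans (cong (map suc) (sym (upTo-∷ʳ m))) (map-++ suc (upTo m) [ m ])

countMultiples-suc : ∀ d m →
  countMultiples d (suc m) ≡ countMultiples d m + length (filter (d ∣?_) [ suc m ])
countMultiples-suc d m = begin
  length (filter (d ∣?_) (range1 (suc m)))
    ≡⟨ cong (length ∘ filter (d ∣?_)) (range1-suc m) ⟩
  length (filter (d ∣?_) (range1 m ++ [ suc m ]))
    ≡⟨ cong length (filter-++ (d ∣?_) (range1 m) [ suc m ]) ⟩
  length (filter (d ∣?_) (range1 m) ++ filter (d ∣?_) [ suc m ])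
    ≡⟨ length-++ (filter (d ∣?_) (range1 m)) ⟩
  countMultiples d m + length (filter (d ∣?_) [ suc m ]) ∎
  where open ≡-Reasoning

countMultiples-suc-∣ : ∀ {d m} → d ∣ suc m → countMultiples d (suc m) ≡ suc (countMultiples d m)
countMultiples-suc-∣ {d} {m} d∣ = trans (countMultiples-suc d m)
  (trans (cong (λ xs → countMultiples d m + length xs) (filter-accept (d ∣?_) d∣))
         (+-comm (countMultiples d m) 1))

countMultiples-suc-∤ : ∀ {d m} → ¬ d ∣ suc m → countMultiples d (suc m) ≡ countMultiples d m
countMultiples-suc-∤ {d} {m} d∤ = trans (countMultiples-suc d m)
  (trans (cong (λ xs → countMultiples d m + length xs) (filter-reject (d ∣?_) d∤))
         (+-identityʳ (countMultiples d m)))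

countMultiples-gap : ∀ d .{{_ : NonZero d}} q r → r < d →
                     countMultiples d (r + q * d) ≡ countMultiples d (q * d)
countMultiples-gap d q zero _ = refl
countMultiples-gap d q (suc r) r<d =
  trans (countMultiples-suc-∤ d∤) (countMultiples-gap d q r (<⇒≤ r<d))
  where
  d∤ : ¬ d ∣ suc r + q * d
  d∤ d∣ = <⇒≱ r<d (∣⇒≤ (∣m+n∣m⇒∣n (subst (d ∣_) (+-comm (suc r) (q * d)) d∣) (n∣m*n q)))

countMultiples-* : ∀ d .{{_ : NonZero d}} q → countMultiples d (q * d) ≡ q
countMultiples-* (suc d) zero = refl
countMultiples-* d@(suc d′) (suc q) = begin
  countMultiples d (suc (d′ + q * d))  ≡⟨ countMultiples-suc-∣ {d} {d′ + q * d} (n∣m*n (suc q)) ⟩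
  suc (countMultiples d (d′ + q * d))  ≡⟨ cong suc (countMultiples-gap d q d′ ≤-refl) ⟩
  suc (countMultiples d (q * d))       ≡⟨ cong suc (countMultiples-* d q) ⟩
  suc q                                ∎
  where open ≡-Reasoning

countMultiples≡/ : ∀ d .{{_ : NonZero d}} m → countMultiples d m ≡ m / d
countMultiples≡/ d m = begin
  countMultiples d m                    ≡⟨ cong (countMultiples d) (m≡m%n+[m/n]*n m d) ⟩
  countMultiples d (m % d + m / d * d)  ≡⟨ countMultiples-gap d (m / d) (m % d) (m%n<n m d) ⟩
  countMultiples d (m / d * d)          ≡⟨ countMultiples-* d (m / d) ⟩
  m / d                                 ∎
  where open ≡-Reasoning

A≡countMultiples : ∀ {P} Q .{{_ : NonZero Q}} → SquareFree P →
  A (P * (Q * Q)) ≡ countMultiples (P * Q) (2 * (P * (Q * Q) / 4) ∸ 1)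
A≡countMultiples {P} Q sf = cong length (filter-≐ (λ k → P * (Q * Q) ∣? k * k) (P * Q ∣?_)
  ((λ {k} → P*Q²∣k²⇒P*Q∣k Q k sf) , λ {k} → P*Q∣k⇒P*Q²∣k² P Q {k})
  (range1 (2 * (P * (Q * Q) / 4) ∸ 1)))

quotient-unique : ∀ {m d q} .{{_ : NonZero d}} → q * d ≤ m → m < suc q * d → m / d ≡ q
quotient-unique {m} {d} {q} lower upper = ≤-antisym
  (s≤s⁻¹ (m<n*o⇒m/o<n upper))
  (subst (_≤ m / d) (m*n/n≡m q d) (/-monoˡ-≤ d lower))

[m*n∸1]/n≡m∸1 : ∀ m n .{{_ : NonZero n}} → (m * n ∸ 1) / n ≡ m ∸ 1
[m*n∸1]/n≡m∸1 zero n = m<n⇒m/n≡0 (>-nonZero⁻¹ n)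
[m*n∸1]/n≡m∸1 (suc m) n@(suc n′) = quotient-unique (m≤n+m (m * n) n′) (n<1+n (n′ + m * n))

2*[n/4]<n : ∀ n .{{_ : NonZero n}} → 2 * (n / 4) < n
2*[n/4]<n n = begin-strict
  2 * (n / 4)      ≡⟨ cong (2 *_) (m/n/o≡m/[n*o] n 2 2) ⟨
  2 * (n / 2 / 2)  ≡⟨ *-comm 2 (n / 2 / 2) ⟩
  n / 2 / 2 * 2    ≤⟨ m/n*n≤m (n / 2) 2 ⟩
  n / 2            <⟨ m/n<m n 2 (s≤s (s≤s z≤n)) ⟩
  n                ∎
  where open ≤-Reasoning

A-fourSquareFree : ∀ {P} → SquareFree P → ∀ Q → A (4 * P * (Q * Q)) ≡ Q ∸ 1
A-fourSquareFree {P} _ zero = cong A (*-zeroʳ (4 * P))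
A-fourSquareFree {P} sf Q@(suc _) = begin
  A (4 * P * (Q * Q))                          ≡⟨ cong A (4P*[Q*Q]≡P*[2Q*2Q] P Q) ⟩
  A (P * (2 * Q * (2 * Q)))                    ≡⟨ A≡countMultiples (2 * Q) sf ⟩
  countMultiples d (2 * (P * (2 * Q * (2 * Q)) / 4) ∸ 1)
                                               ≡⟨ countMultiples≡/ d _ ⟩
  (2 * (P * (2 * Q * (2 * Q)) / 4) ∸ 1) / d    ≡⟨ cong (λ x → (2 * x ∸ 1) / d) quarter ⟩
  (2 * (P * (Q * Q)) ∸ 1) / d                  ≡⟨ cong (λ x → (x ∸ 1) / d) (2*[P*[Q*Q]]≡Q*[P*2Q] P Q) ⟩
  (Q * d ∸ 1) / d                              ≡⟨ [m*n∸1]/n≡m∸1 Q d ⟩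
  Q ∸ 1                                        ∎
  where
  open ≡-Reasoning
  d = P * (2 * Q)
  instance
    d≢0 : NonZero d
    d≢0 = m*n≢0 P (2 * Q) {{squareFree⇒nonZero sf}}
  4P*[Q*Q]≡P*[2Q*2Q] : ∀ P Q → 4 * P * (Q * Q) ≡ P * (2 * Q * (2 * Q))
  4P*[Q*Q]≡P*[2Q*2Q] = solve-∀
  P*[2Q*2Q]≡P*[Q*Q]*4 : ∀ P Q → P * (2 * Q * (2 * Q)) ≡ P * (Q * Q) * 4
  P*[2Q*2Q]≡P*[Q*Q]*4 = solve-∀
  2*[P*[Q*Q]]≡Q*[P*2Q] : ∀ P Q → 2 * (P * (Q * Q)) ≡ Q * (P * (2 * Q))
  2*[P*[Q*Q]]≡Q*[P*2Q] = solve-∀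
  quarter : P * (2 * Q * (2 * Q)) / 4 ≡ P * (Q * Q)
  quarter = trans (cong (_/ 4) (P*[2Q*2Q]≡P*[Q*Q]*4 P Q)) (m*n/n≡m (P * (Q * Q)) 4)

A-oddSquareFree : ∀ {P} → SquareFree P → ∀ h → A (P * ((1 + 2 * h) * (1 + 2 * h))) ≡ h
A-oddSquareFree {P} sf h = begin-equality
  A (P * (Q * Q))                                ≡⟨ A≡countMultiples Q sf ⟩
  countMultiples (P * Q) (2 * (P * (Q * Q) / 4) ∸ 1)
                                                 ≡⟨ countMultiples≡/ (P * Q) _ ⟩
  (2 * (P * (Q * Q) / 4) ∸ 1) / (P * Q)          ≡⟨ cong (λ x → (2 * x ∸ 1) / (P * Q)) quarter ⟩
  (2 * (P / 4 + t) ∸ 1) / (P * Q)                ≡⟨ quotient-unique (lower h) upper ⟩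
  h                                              ∎
  where
  open ≤-Reasoning
  Q = 1 + 2 * h
  t = P * (h * h + h)
  instance
    P≢0 : NonZero P
    P≢0 = squareFree⇒nonZero sf
    PQ≢0 : NonZero (P * Q)
    PQ≢0 = m*n≢0 P Q
  P*Q²≡P+t*4 : ∀ P h → P * ((1 + 2 * h) * (1 + 2 * h)) ≡ P + P * (h * h + h) * 4
  P*Q²≡P+t*4 = solve-∀
  hPQ+Ph≡2t : ∀ P h → h * (P * (1 + 2 * h)) + P * h ≡ 2 * (P * (h * h + h))
  hPQ+Ph≡2t = solve-∀
  P+2t+Ph≡[1+h]PQ : ∀ P h → P + 2 * (P * (h * h + h)) + P * h ≡ suc h * (P * (1 + 2 * h))
  P+2t+Ph≡[1+h]PQ = solve-∀
  quarter : P * (Q * Q) / 4 ≡ P / 4 + t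
  quarter = begin-equality
    P * (Q * Q) / 4  ≡⟨ cong (_/ 4) (P*Q²≡P+t*4 P h) ⟩
    (P + t * 4) / 4  ≡⟨ +-distrib-/-∣ʳ P (n∣m*n t) ⟩
    P / 4 + t * 4 / 4 ≡⟨ cong (P / 4 +_) (m*n/n≡m t 4) ⟩
    P / 4 + t        ∎
  lower : ∀ h → h * (P * (1 + 2 * h)) ≤ 2 * (P / 4 + P * (h * h + h)) ∸ 1
  lower zero = z≤n
  lower h@(suc _) = ∸-monoˡ-≤ 1 (begin-strict
    h * (P * (1 + 2 * h))          <⟨ m<m+n _ (>-nonZero⁻¹ (P * h) {{m*n≢0 P h}}) ⟩
    h * (P * (1 + 2 * h)) + P * h  ≡⟨ hPQ+Ph≡2t P h ⟩
    2 * (P * (h * h + h))          ≤⟨ *-monoʳ-≤ 2 (m≤n+m _ (P / 4)) ⟩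
    2 * (P / 4 + P * (h * h + h))  ∎)
  upper : 2 * (P / 4 + t) ∸ 1 < suc h * (P * Q)
  upper = begin-strict
    2 * (P / 4 + t) ∸ 1  ≤⟨ m∸n≤m _ 1 ⟩
    2 * (P / 4 + t)      ≡⟨ *-distribˡ-+ 2 (P / 4) t ⟩
    2 * (P / 4) + 2 * t  <⟨ +-monoˡ-< (2 * t) (2*[n/4]<n P) ⟩
    P + 2 * t            ≤⟨ m≤m+n (P + 2 * t) (P * h) ⟩
    P + 2 * t + P * h    ≡⟨ P+2t+Ph≡[1+h]PQ P h ⟩
    suc h * (P * Q)      ∎

data EvenOrOdd : ℕ → Set where
  even : ∀ h → EvenOrOdd (2 * h)
  odd  : ∀ h → EvenOrOdd (1 + 2 * h)

evenOrOdd : ∀ n → EvenOrOdd n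
evenOrOdd zero = even 0
evenOrOdd (suc n) with evenOrOdd n
... | even h = odd h
... | odd h  = subst EvenOrOdd (cong suc (+-suc h (h + 0))) (even (suc h))

lemma2p3 : (n : ℕ) → n ≥ 1 →
    ((P Q : ℕ) → ¬ (4 ∣ n) → n ≡ P * (Q * Q) → SquareFree P → Q ≥ 1 →
        2 * A n ≡ Q ∸ 1)
    × ((P Q : ℕ) → n ≡ 4 * P * (Q * Q) → SquareFree P → Q ≥ 1 →
        A n ≡ Q ∸ 1)
lemma2p3 n _ = partA , partB
  where
  partA : (P Q : ℕ) → ¬ (4 ∣ n) → n ≡ P * (Q * Q) → SquareFree P → Q ≥ 1 →
          2 * A n ≡ Q ∸ 1
  partA P Q 4∤n n≡PQ² sf _ with evenOrOdd Q
  ... | even h = contradiction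
    (subst (4 ∣_) (sym n≡PQ²) (∣-trans (*-pres-∣ (m∣m*n {2} h) (m∣m*n {2} h)) (n∣m*n P))) 4∤n
  ... | odd h  = cong (2 *_) (trans (cong A n≡PQ²) (A-oddSquareFree sf h))
  partB : (P Q : ℕ) → n ≡ 4 * P * (Q * Q) → SquareFree P → Q ≥ 1 → A n ≡ Q ∸ 1
  partB P Q n≡4PQ² sf _ = trans (cong A n≡4PQ²) (A-fourSquareFree sf Q)
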